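{- Let $n$ be a positive integer. For every $\alpha\in S_{2n+1}(2n+1)$ there exist $x_2,x_3,\ldots,x_{2n+1}\in S_{2n+1}(2n+1)$ such that $x_2,\ldots,x_{2n}$ are pairwise distinct and $\alpha+\sum_{k=2}^{2n}x_k=2n\,x_{2n+1}$.
   Context: For an integer $m\ge3$, $S_m$ is the sequence defined greedily by $a_0=0$ and, having chosen $a_0,\ldots,a_k$, $a_{k+1}$ is the least integer greater than $a_k$ such that there are no distinct $x_1,\ldots,x_m\in\{a_0,\ldots,a_{k+1}\}$ with $x_1+\cdots+x_{m-1}=(m-1)x_m$. $S_m(k)$ denotes the set of terms of $S_m$ that are at most $k$. -}

module Defs where

open import Data.Nat using (ℕ; zero; suc; _+_; _*_; _∸_)
open import Data.List using (List; []; _∷_; _++_; [_]; length)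
open import Data.Nat.ListAction using (sum)
open import Data.List.Membership.Propositional using (_∈_)
open import Data.List.Relation.Unary.All using (All)
open import Data.List.Relation.Unary.Unique.Propositional using (Unique)
open import Data.Product using (Σ; _×_)
open import Relation.Binary.PropositionalEquality using (_≡_)
open import Relation.Nullary using (¬_)

-- Bad m A : there are distinct x₁,…,x_m ∈ A with x₁ + ⋯ + x_{m-1} = (m-1) x_m.
-- The distinct elements are given as the list  y ∷ xs  with y = x_m and
-- xs = [x₁,…,x_{m-1}]; Unique (y ∷ xs) says they are pairwise distinct.
Bad : ℕ → List ℕ → Set
Bad m A =
  Σ (List ℕ) λ xs → Σ ℕ λ y →
    Unique (y ∷ xs) × All (_∈ A) (y ∷ xs) ×
    length xs ≡ m ∸ 1 × sum xs ≡ (m ∸ 1) * y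

-- GreedyUpTo m k L : L is the (increasing) list of terms of S_m that are ≤ k,
-- i.e. the set S_m(k).  The greedy rule "a_{j+1} is the least integer > a_j
-- such that {a_0,…,a_{j+1}} contains no bad configuration" is equivalent to
-- scanning 1,2,3,… in order and adding each integer iff adding it keeps the
-- set free of bad configurations.  This relation is functional in k.
data GreedyUpTo (m : ℕ) : ℕ → List ℕ → Set where
  start : GreedyUpTo m zero (0 ∷ [])
  take  : ∀ {k L} → GreedyUpTo m k L → ¬ Bad m (L ++ [ suc k ]) →
          GreedyUpTo m (suc k) (L ++ [ suc k ])
  skip  : ∀ {k L} → GreedyUpTo m k L → Bad m (L ++ [ suc k ]) →
          GreedyUpTo m (suc k) L

module Submission where

-- Let m = 2n + 1 and N = m - 1 = 2n.  A bad configuration consists of m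
-- distinct integers, so a set of integers all smaller than N contains
-- none.  Hence the greedy construction keeps every integer below N, and
-- S = S_m(2n+1) contains {0, …, N-1}, while every element of S is ≤ N+1.
--
-- Let T = 0 + 1 + ⋯ + (N-1) = n(2n-1).  For α ∈ S we take as x_2,…,x_{2n}
-- the list 0, …, N-1 with one element z < N deleted; then
-- α + Σ x_k = α + T - z, and it suffices to choose z so that this equals N·y
-- for some y < N:
--   * α < n:       z = α + n, y = n - 1;
--   * n ≤ α < 3n:  z = α - n, y = n;
--   * α ≥ 3n:      since α ≤ 2n + 1 this forces n = 1 and α = 3, and
--                  α + 3 = 2 · 3 solves the problem directly.

open import Defs
open import Data.Nat using (ℕ; zero; suc; _+_; _*_; _∸_; _≤_; _<_; z≤n; s≤s; z<s; _≟_; _<?_)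
open import Data.Nat.Properties
open import Data.Nat.Tactic.RingSolver using (solve-∀)
open import Data.Nat.ListAction using (sum)
open import Data.Nat.ListAction.Properties using (sum-↭)
open import Data.List using (List; []; _∷_; _++_; [_]; length; filter; downFrom)
open import Data.List.Properties using (filter-all; filter-accept; filter-reject; length-downFrom)
open import Data.List.Membership.Propositional using (_∈_; _∉_)
open import Data.List.Membership.DecPropositional _≟_ using (_∈?_)
open import Data.List.Membership.Propositional.Properties using (∈-++⁺ˡ; ∈-++⁺ʳ; ∈-downFrom⁺; ∈-downFrom⁻)
open import Data.List.Relation.Unary.All as All using (All; []; _∷_)
open import Data.List.Relation.Unary.All.Properties as AllP using (++⁺; ¬Any⇒All¬)
open import Data.List.Relation.Unary.Any using (here; there)
open import Data.List.Relation.Unary.AllPairs using ([]; _∷_)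
open import Data.List.Relation.Unary.Unique.Propositional using (Unique)
open import Data.List.Relation.Unary.Unique.Propositional.Properties
  using (downFrom⁺; Unique[x∷xs]⇒x∉xs)
import Data.List.Relation.Unary.Unique.Propositional.Properties as Unique
open import Data.List.Relation.Binary.Permutation.Propositional using (_↭_; refl; prep; swap; ↭-trans)
open import Data.List.Relation.Binary.Permutation.Propositional.Properties using (↭-length)
open import Data.Product using (Σ; _×_; _,_)
open import Data.Sum using (inj₁; inj₂)
open import Data.Empty using (⊥-elim)
open import Function using (_∘_)
open import Relation.Nullary using (¬_; ¬?; yes; no)
open import Relation.Binary.PropositionalEquality hiding ([_])

_∖_ : List ℕ → ℕ → List ℕ
xs ∖ z = filter (λ x → ¬? (x ≟ z)) xs

∖-unique : ∀ {xs} z → Unique xs → Unique (xs ∖ z)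
∖-unique z = Unique.filter⁺ (λ x → ¬? (x ≟ z))

∖-all : ∀ {P : ℕ → Set} {xs} z → All P xs → All P (xs ∖ z)
∖-all z = AllP.filter⁺ (λ x → ¬? (x ≟ z))

∖-≢ : ∀ xs z → All (λ x → ¬ x ≡ z) (xs ∖ z)
∖-≢ xs z = AllP.all-filter (λ x → ¬? (x ≟ z)) xs

∖-absent : ∀ {xs z} → z ∉ xs → xs ∖ z ≡ xs
∖-absent {xs} z∉xs =
  filter-all (λ x → ¬? (x ≟ _)) (All.map (_∘ sym) (¬Any⇒All¬ xs z∉xs))

∖-↭ : ∀ {xs z} → Unique xs → z ∈ xs → xs ↭ z ∷ xs ∖ z
∖-↭ {x ∷ xs} (x∉xs ∷ u) (here refl)
  rewrite filter-reject (λ y → ¬? (y ≟ x)) {x} {xs} (λ x≢x → x≢x refl)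
        | ∖-absent {xs} {x} (Unique[x∷xs]⇒x∉xs (x∉xs ∷ u)) = refl
∖-↭ {x ∷ xs} {z} (x∉xs ∷ u) (there z∈xs) with x ≟ z
... | yes refl = ∖-↭ (x∉xs ∷ u) (here refl)
... | no x≢z rewrite filter-accept (λ y → ¬? (y ≟ z)) {x} {xs} x≢z =
  ↭-trans (prep x (∖-↭ u z∈xs)) (swap x z refl)

unique-bounded-length : ∀ B {xs} → Unique xs → All (_< B) xs → length xs ≤ B
unique-bounded-length zero _ [] = z≤n
unique-bounded-length zero _ (() ∷ _)
unique-bounded-length (suc B) {xs} u xs<1+B = begin
  length xs             ≤⟨ deletion-loses-at-most-one ⟩
  suc (length (xs ∖ B)) ≤⟨ s≤s (unique-bounded-length B (∖-unique B u) rest<B) ⟩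
  suc B                 ∎
  where
  open ≤-Reasoning
  rest<B : All (_< B) (xs ∖ B)
  rest<B = All.zipWith (λ (x<1+B , x≢B) → ≤∧≢⇒< (≤-pred x<1+B) x≢B)
                       (∖-all B xs<1+B , ∖-≢ xs B)
  deletion-loses-at-most-one : length xs ≤ suc (length (xs ∖ B))
  deletion-loses-at-most-one with B ∈? xs
  ... | yes B∈xs = ≤-reflexive (↭-length (∖-↭ u B∈xs))
  ... | no B∉xs rewrite ∖-absent B∉xs = n≤1+n (length xs)

-- A set all of whose elements are below m - 1 has fewer than m elements,
-- so it contains no bad configuration.
small-sets-are-good : ∀ m A → All (_< m ∸ 1) A → ¬ Bad m A
small-sets-are-good m A A<m-1 (xs , y , u , y∷xs⊆A , len , _) =
  <-irrefl refl (begin-strict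
    m ∸ 1              <⟨ n<1+n (m ∸ 1) ⟩
    suc (m ∸ 1)        ≡⟨ cong suc (sym len) ⟩
    length (y ∷ xs)    ≤⟨ unique-bounded-length (m ∸ 1) u (All.map (All.lookup A<m-1) y∷xs⊆A) ⟩
    m ∸ 1              ∎)
  where open ≤-Reasoning

greedy-bounded : ∀ {m k L} → GreedyUpTo m k L → All (_≤ k) L
greedy-bounded start = z≤n ∷ []
greedy-bounded (take g _) = ++⁺ (All.map m≤n⇒m≤1+n (greedy-bounded g)) (≤-refl ∷ [])
greedy-bounded (skip g _) = All.map m≤n⇒m≤1+n (greedy-bounded g)

-- Every integer i ≤ k below m - 1 belongs to S_m(k): adding it can never
-- create a bad configuration.
greedy-initial : ∀ {m k L} → GreedyUpTo m k L → ∀ {i} → i ≤ k → i < m ∸ 1 → i ∈ L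
greedy-initial start z≤n _ = here refl
greedy-initial {m} {suc k} g i≤1+k i<m-1 with m≤n⇒m<n∨m≡n i≤1+k | g
... | inj₁ i<1+k | take g′ _ = ∈-++⁺ˡ (greedy-initial g′ (≤-pred i<1+k) i<m-1)
... | inj₁ i<1+k | skip g′ _ = greedy-initial g′ (≤-pred i<1+k) i<m-1
... | inj₂ refl | take {L = L} _ _ = ∈-++⁺ʳ L (here refl)
... | inj₂ refl | skip {L = L} g′ bad =
  ⊥-elim (small-sets-are-good m (L ++ [ suc k ]) all<m-1 bad)
  where
  all<m-1 : All (_< m ∸ 1) (L ++ [ suc k ])
  all<m-1 = ++⁺ (All.map (λ x≤k → <-trans (s≤s x≤k) i<m-1) (greedy-bounded g′))
                (i<m-1 ∷ [])

sum-downFrom : ∀ k → sum (downFrom k) * 2 + k ≡ k * k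
sum-downFrom zero = refl
sum-downFrom (suc k) = begin
  (k + T) * 2 + suc k       ≡⟨ regroup k T ⟩
  (T * 2 + k) + (k + k + 1) ≡⟨ cong (_+ (k + k + 1)) (sum-downFrom k) ⟩
  k * k + (k + k + 1)       ≡⟨ square-suc k ⟩
  suc k * suc k             ∎
  where
  open ≡-Reasoning
  T = sum (downFrom k)
  regroup : ∀ k T → (k + T) * 2 + suc k ≡ (T * 2 + k) + (k + k + 1)
  regroup = solve-∀
  square-suc : ∀ k → k * k + (k + k + 1) ≡ suc k * suc k
  square-suc = solve-∀

sum-downFrom-even : ∀ n → sum (downFrom (2 * n)) + n ≡ 2 * n * n
sum-downFrom-even n = *-cancelʳ-≡ _ _ 2 (begin
  (T + n) * 2           ≡⟨ distribute n T ⟩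
  T * 2 + 2 * n         ≡⟨ sum-downFrom (2 * n) ⟩
  (2 * n) * (2 * n)     ≡⟨ square-double n ⟩
  (2 * n * n) * 2       ∎)
  where
  open ≡-Reasoning
  T = sum (downFrom (2 * n))
  distribute : ∀ n T → (T + n) * 2 ≡ T * 2 + 2 * n
  distribute = solve-∀
  square-double : ∀ n → (2 * n) * (2 * n) ≡ (2 * n * n) * 2
  square-double = solve-∀

Representation : ℕ → List ℕ → ℕ → Set
Representation N S α =
  Σ (List ℕ) λ xs → Σ ℕ λ y →
    length xs ≡ N ∸ 1 × Unique xs × All (_∈ S) xs × y ∈ S × α + sum xs ≡ N * y

represent-by-deletion : ∀ N S α z y → (∀ {i} → i < N → i ∈ S) → z < N → y ∈ S →
  α + sum (downFrom N) ≡ z + N * y → Representation N S α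
represent-by-deletion N S α z y below-N⊆S z<N y∈S eq =
  xs , y , length-xs , ∖-unique z (downFrom⁺ N) ,
  ∖-all z (All.tabulate (below-N⊆S ∘ ∈-downFrom⁻)) , y∈S , sum-eq
  where
  xs = downFrom N ∖ z
  moved : downFrom N ↭ z ∷ xs
  moved = ∖-↭ (downFrom⁺ N) (∈-downFrom⁺ z<N)
  length-xs : length xs ≡ N ∸ 1
  length-xs = cong (_∸ 1) (trans (sym (↭-length moved)) (length-downFrom N))
  sum-eq : α + sum xs ≡ N * y
  sum-eq = +-cancelˡ-≡ z _ _ (begin
    z + (α + sum xs)    ≡⟨ x+[y+z]≡y+[x+z] z α (sum xs) ⟩
    α + (z + sum xs)    ≡⟨ cong (α +_) (sym (sum-↭ moved)) ⟩
    α + sum (downFrom N) ≡⟨ eq ⟩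
    z + N * y           ∎)
    where
    open ≡-Reasoning
    x+[y+z]≡y+[x+z] : ∀ x y z → x + (y + z) ≡ y + (x + z)
    x+[y+z]≡y+[x+z] = solve-∀

below-2n-in-S : ∀ {n S} → GreedyUpTo (2 * n + 1) (2 * n + 1) S → ∀ {i} → i < 2 * n → i ∈ S
below-2n-in-S {n} g {i} i<2n =
  greedy-initial g (≤-trans (<⇒≤ i<2n) (m≤m+n (2 * n) 1))
                   (subst (i <_) (sym (m+n∸n≡m (2 * n) 1)) i<2n)

-- Case α < n: delete z = α + n and take y = n - 1.
low-identity : ∀ p α → α + sum (downFrom (2 * suc p)) ≡ (α + suc p) + 2 * suc p * p
low-identity p α = begin
  α + T                     ≡⟨ cong (α +_) T≡ ⟩
  α + (2 * n * p + n)       ≡⟨ regroup α (2 * n * p) n ⟩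
  (α + n) + 2 * n * p       ∎
  where
  open ≡-Reasoning
  n = suc p
  T = sum (downFrom (2 * n))
  T≡ : T ≡ 2 * n * p + n
  T≡ = +-cancelʳ-≡ n _ _ (trans (sum-downFrom-even n) (expand p))
    where
    expand : ∀ p → 2 * suc p * suc p ≡ (2 * suc p * p + suc p) + suc p
    expand = solve-∀
  regroup : ∀ a b c → a + (b + c) ≡ (a + c) + b
  regroup = solve-∀

-- Case n ≤ α: delete z = α - n and take y = n.
mid-identity : ∀ n α → n ≤ α → α + sum (downFrom (2 * n)) ≡ (α ∸ n) + 2 * n * n
mid-identity n α n≤α = begin
  α + T                 ≡⟨ cong (_+ T) (sym (m∸n+n≡m n≤α)) ⟩
  ((α ∸ n) + n) + T     ≡⟨ +-assoc (α ∸ n) n T ⟩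
  (α ∸ n) + (n + T)     ≡⟨ cong ((α ∸ n) +_) (trans (+-comm n T) (sum-downFrom-even n)) ⟩
  (α ∸ n) + 2 * n * n   ∎
  where
  open ≡-Reasoning
  T = sum (downFrom (2 * n))

high-case : ∀ p α → suc p + 2 * suc p ≤ α → α ≤ 2 * suc p + 1 → p ≡ 0 × α ≡ 3
high-case p α 3n≤α α≤2n+1
  with +-cancelʳ-≤ (2 * suc p) (suc p) 1
         (≤-trans 3n≤α (≤-trans α≤2n+1 (≤-reflexive (+-comm (2 * suc p) 1))))
... | s≤s z≤n = refl , ≤-antisym α≤2n+1 3n≤α

lemma11 : (n : ℕ) → 1 ≤ n → (S : List ℕ) → GreedyUpTo (2 * n + 1) (2 * n + 1) S →
    (α : ℕ) → α ∈ S →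
    Σ (List ℕ) λ xs → Σ ℕ λ y →
      length xs ≡ 2 * n ∸ 1 × Unique xs × All (_∈ S) xs × y ∈ S ×
      α + sum xs ≡ (2 * n) * y
lemma11 n@(suc p) _ S g α α∈S with α <? n | α <? n + 2 * n
... | yes α<n | _ =
  represent-by-deletion (2 * n) S α (α + n) p (below-2n-in-S {n} g)
                        (<-≤-trans (+-monoˡ-< n α<n) (+-monoʳ-≤ n (m≤m+n n 0)))
                        (below-2n-in-S {n} g (m≤m+n n (n + 0))) (low-identity p α)
... | no α≮n | yes α<3n =
  represent-by-deletion (2 * n) S α (α ∸ n) n (below-2n-in-S {n} g) (m<n+o⇒m∸n<o α n α<3n)
                        (below-2n-in-S {n} g (m<m+n n z<s)) (mid-identity n α (≮⇒≥ α≮n))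
... | no _ | no α≮3n
  with high-case p α (≮⇒≥ α≮3n) (All.lookup (greedy-bounded g) α∈S)
...   | refl , refl = [ 3 ] , 3 , refl , [] ∷ [] , α∈S ∷ [] , α∈S , refl
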